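{- Let $G$ be the graph obtained from a 4-cycle $v_1v_2v_3v_4v_1$ by adding a vertex $v_5$ adjacent only to $v_1$, and let $y\ge 3$ be an integer. Suppose that $L'$ assigns sets of forbidden colours $L'(v_i)\subseteq\{1,\dots,y+1\}$ to the vertices of $G$, with $L'(v_i)$ nonempty for $i=2,3,4,5$. Then: (a) $Q_{G,L'}(y)\le y^5-4y^4+10y^3-13y^2+10y-3$; (b) if $|L'(v_5)|\ge 2$, then $Q_{G,L'}(y)\le y^5-5y^4+14y^3-23y^2+23y-11$.
   Context: For a graph $G$ and an assignment $L'$ of sets of forbidden colours with $\bigcup_v L'(v)\subseteq\{1,\dots,y+1\}$, $Q_{G,L'}(y)$ denotes the number of proper colourings $c:V(G)\to\{1,\dots,y+1\}$ (adjacent vertices get different colours) with $c(v)\notin L'(v)$ for every vertex $v$. -}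

module Defs where

open import Data.Nat using (ℕ; zero; suc)
open import Data.Bool using (Bool; true; false; T; _∨_)
open import Data.Bool.Properties using (T?)
open import Data.Fin using (Fin; zero; suc)
open import Data.Fin.Properties using (all?; _≟_)
open import Data.Fin.Subset using (Subset; _∈_; _∉_)
open import Data.Fin.Subset.Properties using (_∈?_)
open import Data.List using (List; []; _∷_; map; concatMap; filter; length)
open import Data.List.Base using (allFin)
open import Data.Product using (_×_; _,_)
open import Data.Product.Properties using ()
open import Relation.Nullary using (Dec; yes; no; ¬_)
open import Relation.Nullary.Decidable using (_×-dec_; ¬?; _→-dec_)
open import Relation.Binary.PropositionalEquality using (_≡_; _≢_)
import Data.Vec.Functional as VF

Graph : ℕ → Set
Graph n = Fin n → Fin n → Bool

-- Colours {1,…,y+1} are represented by Fin (suc y) (colour i+1 ↦ i).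
-- A forbidden-colour assignment L' : each vertex gets a subset of the colours.
ForbiddenAssignment : ℕ → ℕ → Set
ForbiddenAssignment n y = Fin n → Subset (suc y)

IsProperAvoiding : ∀ {n y} → Graph n → ForbiddenAssignment n y
                 → (Fin n → Fin (suc y)) → Set
IsProperAvoiding G L c =
  (∀ u v → T (G u v) → c u ≢ c v) × (∀ v → c v ∉ L v)

isProperAvoiding? : ∀ {n y} (G : Graph n) (L : ForbiddenAssignment n y)
                    (c : Fin _ → Fin (suc y)) → Dec (IsProperAvoiding G L c)
isProperAvoiding? G L c =
  all? (λ u → all? (λ v → T? (G u v) →-dec ¬? (c u ≟ c v)))
  ×-dec all? (λ v → ¬? (c v ∈? L v))

allFuns : (n k : ℕ) → List (Fin n → Fin k)
allFuns zero    k = VF.[] ∷ []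
allFuns (suc n) k =
  concatMap (λ a → map (λ f → a VF.∷ f) (allFuns n k)) (allFin k)

Q : ∀ {n} → Graph n → (y : ℕ) → ForbiddenAssignment n y → ℕ
Q {n} G y L = length (filter (isProperAvoiding? G L) (allFuns n (suc y)))

pattern v1 = zero
pattern v2 = suc zero
pattern v3 = suc (suc zero)
pattern v4 = suc (suc (suc zero))
pattern v5 = suc (suc (suc (suc zero)))

edge : Fin 5 → Fin 5 → Bool
edge v1 v2 = true
edge v2 v3 = true
edge v3 v4 = true
edge v4 v1 = true
edge v1 v5 = true
edge _  _  = false

C4plusPendant : Graph 5
C4plusPendant u v = edge u v ∨ edge v u

-- Fix forbidden colours ℓ₂ ∈ L'(v₂), ℓ₃ ∈ L'(v₃), ℓ₄ ∈ L'(v₄) and a list F₅ ⊆ L'(v₅) of one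
-- (part a) or two (part b) distinct colours, and forget every other constraint coming from L'.
-- Summing out v₅, v₄ and v₂ then gives
--   Q ≤ Σ_{a₁} W(a₁) Σ_{a₃ ≠ ℓ₃} N(ℓ₂,a₁,a₃) N(ℓ₄,a₁,a₃),
-- where N(ℓ,a,b) counts the colours outside {ℓ,a,b} and W(a₁) those outside {a₁} ∪ F₅.
-- By 2xy ≤ x² + y² we get 2Q ≤ S(ℓ₂) + S(ℓ₄), where S(ℓ) is the same sum with N(ℓ,a₁,a₃)² in
-- place of the product, so it suffices to bound one S(ℓ).  Among the k = y + 1 colours, the number
-- outside a set is k minus the number of distinct elements of the set, so the summands of S exceed
-- their generic value only at the colours ℓ, a₁ and those of F₅; splitting the sums there and
-- taking the worst case for the excluded colour ℓ₃ yields the two polynomials.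

module Submission where

open import Defs

module _ where

  import Algebra.Properties.CommutativeSemigroup as CommutativeSemigroupProperties
  open import Data.Bool using (true; false; if_then_else_)
  open import Data.Empty using (⊥-elim)
  open import Data.Fin using (Fin; zero; suc)
  open import Data.Fin.Properties using (_≟_) renaming (suc-injective to Fin-suc-injective)
  open import Data.Fin.Subset using (Subset; inside; outside; Nonempty; ∣_∣; _∈_; _∉_)
  open import Data.List using (List; []; _∷_; length; map; filter; concatMap; tabulate; _++_)
  open import Data.List.Properties using (length-++; filter-++)
  open import Data.List.Relation.Unary.All as All using (All; []; _∷_; all?)
  open import Data.List.Relation.Unary.Unique.Propositional using (Unique; []; _∷_)
  open import Data.Nat using (ℕ; zero; suc; _+_; _*_; _≤_; _⊔_; z≤n; s≤s)
  open import Data.Nat.Properties hiding (_≟_)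
  open import Algebra.Properties.Semiring.Sum +-*-semiring
    using (sum-syntax; sum-cong-≗; ∑-comm; ∑-distrib-+; *-distribˡ-sum; *-distribʳ-sum)
  import Data.Nat.ListAction as List
  open import Data.Nat.Tactic.RingSolver using (solve-∀)
  open import Data.Product using (_×_; _,_; ∃₂)
  open import Data.Sum using (inj₁; inj₂)
  open import Data.Unit using (tt)
  import Data.Vec.Functional as Vector
  open import Data.Vec.Base using (_∷_; here; there)
  open import Function using (_∘_)
  open import Level using (0ℓ)
  open import Relation.Nullary using (does; yes; no; ¬_; ¬?)
  open import Relation.Nullary.Decidable using (dec-false)
  open import Relation.Unary using (Pred; Decidable)
  open import Relation.Binary.PropositionalEquality hiding ([_])

  module +-CS = CommutativeSemigroupProperties +-commutativeSemigroup
  module *-CS = CommutativeSemigroupProperties *-commutativeSemigroup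

  infix 5 [_≢_] [_∉_]

  [_≢_] : ∀ {k} → Fin k → Fin k → ℕ
  [ a ≢ b ] = if does (a ≟ b) then 0 else 1

  [_∉_] : ∀ {k} → Fin k → List (Fin k) → ℕ
  [ c ∉ [] ]     = 1
  [ c ∉ x ∷ xs ] = [ c ≢ x ] * [ c ∉ xs ]

  free : ∀ {k} → List (Fin k) → ℕ
  free {k} xs = ∑[ c < k ] [ c ∉ xs ]

  module _ {k : ℕ} where

    [≢]-≢ : {a b : Fin k} → a ≢ b → [ a ≢ b ] ≡ 1
    [≢]-≢ {a} {b} a≢b rewrite dec-false (a ≟ b) a≢b = refl

    [∉]-all : {c : Fin k} {xs : List (Fin k)} → All (c ≢_) xs → [ c ∉ xs ] ≡ 1
    [∉]-all []           = refl
    [∉]-all (c≢x ∷ c∉xs) rewrite [≢]-≢ c≢x | [∉]-all c∉xs = refl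

    [∉]-¬all : {c : Fin k} {xs : List (Fin k)} → ¬ All (c ≢_) xs → [ c ∉ xs ] ≡ 0
    [∉]-¬all {xs = []}     ¬c∉xs = ⊥-elim (¬c∉xs [])
    [∉]-¬all {c} {x ∷ xs} ¬c∉xs with c ≟ x
    ... | yes _   = refl
    ... | no c≢x rewrite [∉]-¬all (¬c∉xs ∘ (c≢x ∷_)) = refl

    [∉]-*-mono : {c : Fin k} (xs : List (Fin k)) {m n : ℕ} →
                 (All (c ≢_) xs → m ≤ n) → [ c ∉ xs ] * m ≤ [ c ∉ xs ] * n
    [∉]-*-mono {c} xs m≤n with all? (λ x → ¬? (c ≟ x)) xs
    ... | yes c∉xs rewrite [∉]-all c∉xs = *-monoʳ-≤ 1 (m≤n c∉xs)
    ... | no ¬c∉xs rewrite [∉]-¬all ¬c∉xs = z≤n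

    [∉]-antitone : {c : Fin k} {xs : List (Fin k)} (ys : List (Fin k)) →
                   (All (c ≢_) ys → All (c ≢_) xs) → [ c ∉ ys ] ≤ [ c ∉ xs ]
    [∉]-antitone {c} ys ys⇒xs with all? (λ y → ¬? (c ≟ y)) ys
    ... | yes c∉ys rewrite [∉]-all c∉ys | [∉]-all (ys⇒xs c∉ys) = ≤-refl
    ... | no ¬c∉ys rewrite [∉]-¬all ¬c∉ys = z≤n

  ∑-mono-≤ : ∀ {k} {f g : Fin k → ℕ} → (∀ i → f i ≤ g i) → ∑[ i < k ] f i ≤ ∑[ i < k ] g i
  ∑-mono-≤ {zero}  f≤g = z≤n
  ∑-mono-≤ {suc k} f≤g = +-mono-≤ (f≤g zero) (∑-mono-≤ (f≤g ∘ suc))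

  ∑-const : ∀ k (m : ℕ) → ∑[ i < k ] m ≡ k * m
  ∑-const zero    m = refl
  ∑-const (suc k) m = cong (m +_) (∑-const k m)

  ∑-*ˡ : ∀ {k} m (f : Fin k → ℕ) → ∑[ i < k ] (m * f i) ≡ m * ∑[ i < k ] f i
  ∑-*ˡ m f = sym (*-distribˡ-sum m f)

  ∑-split : ∀ {k} (f : Fin k → ℕ) x → ∑[ c < k ] f c ≡ f x + ∑[ c < k ] ([ c ≢ x ] * f c)
  ∑-split         f zero    = cong (f zero +_) (sum-cong-≗ λ c → sym (+-identityʳ (f (suc c))))
  ∑-split {suc k} f (suc x) = begin
    f zero + ∑[ c < k ] f (suc c)                ≡⟨ cong (f zero +_) (∑-split (f ∘ suc) x) ⟩
    f zero + (f (suc x) + rest)                  ≡⟨ +-CS.x∙yz≈y∙xz (f zero) (f (suc x)) rest ⟩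
    f (suc x) + (f zero + rest)                  ≡⟨ cong (λ m → f (suc x) + (m + rest)) (+-identityʳ (f zero)) ⟨
    f (suc x) + ∑[ c < suc k ] ([ c ≢ suc x ] * f c) ∎
    where
    open ≡-Reasoning
    rest = ∑[ c < k ] ([ c ≢ x ] * f (suc c))

  sum-map-mono-≤ : ∀ {A : Set} {xs : List A} {f g : A → ℕ} →
                   All (λ x → f x ≤ g x) xs → List.sum (map f xs) ≤ List.sum (map g xs)
  sum-map-mono-≤ []            = z≤n
  sum-map-mono-≤ (fx≤gx ∷ f≤g) = +-mono-≤ fx≤gx (sum-map-mono-≤ f≤g)

  sum-map-const : ∀ {A : Set} (xs : List A) m → List.sum (map (λ _ → m) xs) ≡ length xs * m
  sum-map-const []       m = refl
  sum-map-const (x ∷ xs) m = cong (m +_) (sum-map-const xs m)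

  sum-map-*ˡ : ∀ {A : Set} (xs : List A) m (f : A → ℕ) → List.sum (map (λ x → m * f x) xs) ≡ m * List.sum (map f xs)
  sum-map-*ˡ []       m f = sym (*-zeroʳ m)
  sum-map-*ˡ (x ∷ xs) m f = trans (cong (m * f x +_) (sum-map-*ˡ xs m f)) (sym (*-distribˡ-+ m (f x) _))

  module _ {k : ℕ} where

    ∑-split-unique : {xs : List (Fin k)} → Unique xs → (f : Fin k → ℕ) →
                     ∑[ c < k ] f c ≡ List.sum (map f xs) + ∑[ c < k ] ([ c ∉ xs ] * f c)
    ∑-split-unique [] f = sum-cong-≗ λ c → sym (+-identityʳ (f c))
    ∑-split-unique {x ∷ xs} (x∉xs ∷ xs!) f = begin
      ∑[ c < k ] f c                                                ≡⟨ ∑-split-unique xs! f ⟩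
      sum-xs + ∑[ c < k ] ([ c ∉ xs ] * f c)                        ≡⟨ cong (sum-xs +_) (∑-split _ x) ⟩
      sum-xs + ([ x ∉ xs ] * f x + ∑[ c < k ] ([ c ≢ x ] * ([ c ∉ xs ] * f c)))
        ≡⟨ cong₂ (λ m n → sum-xs + (m * f x + n)) ([∉]-all x∉xs) (sum-cong-≗ λ c → sym (*-assoc [ c ≢ x ] _ _)) ⟩
      sum-xs + (1 * f x + ∑[ c < k ] ([ c ∉ x ∷ xs ] * f c))          ≡⟨ cong (λ m → sum-xs + (m + rest)) (*-identityˡ (f x)) ⟩
      sum-xs + (f x + ∑[ c < k ] ([ c ∉ x ∷ xs ] * f c))              ≡⟨ +-CS.x∙yz≈yx∙z sum-xs (f x) rest ⟩
      List.sum (map f (x ∷ xs)) + ∑[ c < k ] ([ c ∉ x ∷ xs ] * f c)  ∎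
      where
      open ≡-Reasoning
      sum-xs = List.sum (map f xs)
      rest   = ∑[ c < k ] ([ c ∉ x ∷ xs ] * f c)

    free-unique : {xs : List (Fin k)} → Unique xs → length xs + free xs ≡ k
    free-unique {xs} xs! = begin
      length xs + free xs
        ≡⟨ cong₂ _+_ (sym (*-identityʳ (length xs))) (sum-cong-≗ λ c → sym (*-identityʳ [ c ∉ xs ])) ⟩
      length xs * 1 + ∑[ c < k ] ([ c ∉ xs ] * 1)
        ≡⟨ cong (_+ ∑[ c < k ] ([ c ∉ xs ] * 1)) (sum-map-const xs 1) ⟨
      List.sum (map (λ _ → 1) xs) + ∑[ c < k ] ([ c ∉ xs ] * 1) ≡⟨ ∑-split-unique xs! (λ _ → 1) ⟨
      ∑[ c < k ] 1                                              ≡⟨ ∑-const k 1 ⟩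
      k * 1                                                     ≡⟨ *-identityʳ k ⟩
      k                                                         ∎
      where open ≡-Reasoning

    free-≡ : {xs : List (Fin k)} {r : ℕ} → Unique xs → length xs + r ≡ k → free xs ≡ r
    free-≡ {xs} xs! len+r≡k = +-cancelˡ-≡ (length xs) _ _ (trans (free-unique xs!) (sym len+r≡k))

    free-≤ : {xs ys : List (Fin k)} {r : ℕ} → Unique xs → length xs + r ≡ k →
             (∀ {c} → All (c ≢_) ys → All (c ≢_) xs) → free ys ≤ r
    free-≤ {xs} {ys} {r} xs! len+r≡k ys⇒xs = begin
      free ys  ≤⟨ ∑-mono-≤ {k} (λ c → [∉]-antitone ys ys⇒xs) ⟩
      free xs  ≡⟨ free-≡ xs! len+r≡k ⟩
      r        ∎
      where open ≤-Reasoning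

    ∑-≤-peaks : {xs : List (Fin k)} {r p q : ℕ} {f : Fin k → ℕ} → Unique xs → length xs + r ≡ k →
                All (λ x → f x ≤ p) xs → (∀ c → All (c ≢_) xs → f c ≤ q) →
                ∑[ c < k ] f c ≤ length xs * p + r * q
    ∑-≤-peaks {xs} {r} {p} {q} {f} xs! len+r≡k f≤p f≤q = begin
      ∑[ c < k ] f c                                            ≡⟨ ∑-split-unique xs! f ⟩
      List.sum (map f xs) + ∑[ c < k ] ([ c ∉ xs ] * f c)
        ≤⟨ +-mono-≤ (sum-map-mono-≤ f≤p) (∑-mono-≤ λ c → [∉]-*-mono xs (f≤q c)) ⟩
      List.sum (map (λ _ → p) xs) + ∑[ c < k ] ([ c ∉ xs ] * q)
        ≡⟨ cong₂ _+_ (sum-map-const xs p) (sym (*-distribʳ-sum q (λ c → [ c ∉ xs ]))) ⟩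
      length xs * p + free xs * q                               ≡⟨ cong (λ m → length xs * p + m * q) (free-≡ xs! len+r≡k) ⟩
      length xs * p + r * q                                     ∎
      where open ≤-Reasoning

    ∑-punctured-≤ : (b : Fin k) {f h : Fin k → ℕ} {m : ℕ} → (∀ c → f c ≤ h c) → (∀ c → m ≤ h c) →
                    ∑[ c < k ] ([ c ≢ b ] * f c) + m ≤ ∑[ c < k ] h c
    ∑-punctured-≤ b {f} {h} {m} f≤h m≤h = begin
      ∑[ c < k ] ([ c ≢ b ] * f c) + m   ≤⟨ +-mono-≤ (∑-mono-≤ λ c → *-monoʳ-≤ [ c ≢ b ] (f≤h c)) (m≤h b) ⟩
      ∑[ c < k ] ([ c ≢ b ] * h c) + h b ≡⟨ +-comm _ (h b) ⟩
      h b + ∑[ c < k ] ([ c ≢ b ] * h c) ≡⟨ ∑-split h b ⟨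
      ∑[ c < k ] h c                     ∎
      where open ≤-Reasoning

    ∑-punctured-≤-peaks : {xs : List (Fin k)} {r p q : ℕ} {f : Fin k → ℕ} → Unique xs → length xs + suc r ≡ k →
                          All (λ x → f x ≤ p) xs → (∀ c → All (c ≢_) xs → f c ≤ q) → q ≤ p →
                          (b : Fin k) → ∑[ c < k ] ([ c ≢ b ] * f c) ≤ length xs * p + r * q
    -- Replacing f by f ⊔ q makes the dropped term at least q.
    ∑-punctured-≤-peaks {xs} {r} {p} {q} {f} xs! len+r≡k f≤p f≤q q≤p b = +-cancelʳ-≤ q _ _ (begin
      ∑[ c < k ] ([ c ≢ b ] * f c) + q  ≤⟨ ∑-punctured-≤ b (λ c → m≤m⊔n (f c) q) (λ c → m≤n⊔m (f c) q) ⟩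
      ∑[ c < k ] (f c ⊔ q)              ≤⟨ ∑-≤-peaks xs! len+r≡k (All.map (λ fx≤p → ⊔-lub fx≤p q≤p) f≤p)
                                                                (λ c c∉xs → ⊔-lub (f≤q c c∉xs) ≤-refl) ⟩
      length xs * p + suc r * q         ≡⟨ +-CS.x∙yz≈xz∙y (length xs * p) q (r * q) ⟩
      length xs * p + r * q + q         ∎)
      where open ≤-Reasoning

    ∑-weighted-≤-peaks : {xs : List (Fin k)} {n : ℕ} {w : Fin k → ℕ} → Unique xs →
                         All (λ x → w x ≤ suc n) xs → (∀ c → All (c ≢_) xs → w c ≤ n) → (u : Fin k → ℕ) →
                         ∑[ c < k ] (w c * u c) ≤ List.sum (map u xs) + n * ∑[ c < k ] u c
    ∑-weighted-≤-peaks {xs} {n} {w} xs! w≤1+n w≤n u = begin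
      ∑[ c < k ] (w c * u c)                                           ≡⟨ ∑-split-unique xs! _ ⟩
      List.sum (map (λ x → w x * u x) xs) + ∑[ c < k ] ([ c ∉ xs ] * (w c * u c))
        ≤⟨ +-mono-≤ (sum-map-mono-≤ (All.map (λ {x} → *-monoˡ-≤ (u x)) w≤1+n))
                    (∑-mono-≤ λ c → [∉]-*-mono xs λ c∉xs → *-monoˡ-≤ (u c) (w≤n c c∉xs)) ⟩
      List.sum (map (λ x → suc n * u x) xs) + ∑[ c < k ] ([ c ∉ xs ] * (n * u c))
        ≡⟨ cong₂ _+_ (sum-map-*ˡ xs (suc n) u)
                     (trans (sum-cong-≗ λ c → *-CS.x∙yz≈y∙xz [ c ∉ xs ] n (u c)) (∑-*ˡ n (λ c → [ c ∉ xs ] * u c))) ⟩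
      suc n * peaks + n * rest                                         ≡⟨ +-assoc peaks (n * peaks) (n * rest) ⟩
      peaks + (n * peaks + n * rest)                                   ≡⟨ cong (peaks +_) (*-distribˡ-+ n peaks rest) ⟨
      peaks + n * (peaks + rest)                                       ≡⟨ cong (λ m → peaks + n * m) (∑-split-unique xs! u) ⟨
      peaks + n * ∑[ c < k ] u c                                       ∎
      where
      open ≤-Reasoning
      peaks = List.sum (map u xs)
      rest  = ∑[ c < k ] ([ c ∉ xs ] * u c)

  sumFunctions : (n k : ℕ) → ((Fin n → Fin k) → ℕ) → ℕ
  sumFunctions zero    k g = g Vector.[]
  sumFunctions (suc n) k g = ∑[ a < k ] sumFunctions n k (λ f → g (a Vector.∷ f))

  module _ {A : Set} {P : Pred A 0ℓ} (P? : Decidable P) where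

    length-filter-map : ∀ {B : Set} (f : B → A) xs → length (filter P? (map f xs)) ≡ length (filter (P? ∘ f) xs)
    length-filter-map f []       = refl
    length-filter-map f (x ∷ xs) with does (P? (f x))
    ... | true  = cong suc (length-filter-map f xs)
    ... | false = length-filter-map f xs

    length-filter-concatMap-≤ : ∀ {B : Set} {k} (F : B → List A) (t : Fin k → B) {h : Fin k → ℕ} →
                                (∀ i → length (filter P? (F (t i))) ≤ h i) →
                                length (filter P? (concatMap F (tabulate t))) ≤ ∑[ i < k ] h i
    length-filter-concatMap-≤ {k = zero}  F t bound = z≤n
    length-filter-concatMap-≤ {k = suc k} F t {h} bound = begin
      length (filter P? (F (t zero) ++ concatMap F (tabulate (t ∘ suc))))   ≡⟨ cong length (filter-++ P? (F (t zero)) _) ⟩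
      length (filter P? (F (t zero)) ++ filter P? (concatMap F (tabulate (t ∘ suc))))
        ≡⟨ length-++ (filter P? (F (t zero))) ⟩
      length (filter P? (F (t zero))) + length (filter P? (concatMap F (tabulate (t ∘ suc))))
        ≤⟨ +-mono-≤ (bound zero) (length-filter-concatMap-≤ F (t ∘ suc) (bound ∘ suc)) ⟩
      ∑[ i < suc k ] h i ∎
      where open ≤-Reasoning

  length-filter-allFuns-≤ : ∀ n k {P : Pred (Fin n → Fin k) 0ℓ} (P? : Decidable P) {g : (Fin n → Fin k) → ℕ} →
                            (∀ c → P c → 1 ≤ g c) → length (filter P? (allFuns n k)) ≤ sumFunctions n k g
  length-filter-allFuns-≤ zero    k P? P⇒1≤g with P? Vector.[]
  ... | yes p = P⇒1≤g Vector.[] p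
  ... | no  _ = z≤n
  length-filter-allFuns-≤ (suc n) k P? {g} P⇒1≤g =
    length-filter-concatMap-≤ P? (λ a → map (a Vector.∷_) (allFuns n k)) (λ a → a) λ a → begin
      length (filter P? (map (a Vector.∷_) (allFuns n k))) ≡⟨ length-filter-map P? (a Vector.∷_) (allFuns n k) ⟩
      length (filter (P? ∘ (a Vector.∷_)) (allFuns n k))   ≤⟨ length-filter-allFuns-≤ n k (P? ∘ (a Vector.∷_)) (P⇒1≤g ∘ (a Vector.∷_)) ⟩
      sumFunctions n k (λ c → g (a Vector.∷ c))                 ∎
    where open ≤-Reasoning

  m≤n⇒2*m*n≤m*m+n*n : ∀ {m n} → m ≤ n → 2 * (m * n) ≤ m * m + n * n
  m≤n⇒2*m*n≤m*m+n*n {m} m≤n with o , refl ← m≤n⇒∃[o]m+o≡n m≤n =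
    subst (2 * (m * (m + o)) ≤_) (square-gap m o) (m≤m+n _ (o * o))
    where
    square-gap : ∀ m o → 2 * (m * (m + o)) + o * o ≡ m * m + (m + o) * (m + o)
    square-gap = solve-∀

  2*m*n≤m*m+n*n : ∀ m n → 2 * (m * n) ≤ m * m + n * n
  2*m*n≤m*m+n*n m n with ≤-total m n
  ... | inj₁ m≤n = m≤n⇒2*m*n≤m*m+n*n m≤n
  ... | inj₂ n≤m = subst₂ _≤_ (cong (2 *_) (*-comm n m)) (+-comm (n * n) (m * m)) (m≤n⇒2*m*n≤m*m+n*n n≤m)

  square-mono : ∀ {m n} → m ≤ n → m * m ≤ n * n
  square-mono m≤n = *-mono-≤ m≤n m≤n

  ∑-amgm : ∀ {k} (w f g : Fin k → ℕ) →
           2 * ∑[ i < k ] (w i * (f i * g i)) ≤ ∑[ i < k ] (w i * (f i * f i)) + ∑[ i < k ] (w i * (g i * g i))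
  ∑-amgm {k} w f g = begin
    2 * ∑[ i < k ] (w i * (f i * g i))                      ≡⟨ ∑-*ˡ 2 (λ i → w i * (f i * g i)) ⟨
    ∑[ i < k ] (2 * (w i * (f i * g i)))                    ≤⟨ ∑-mono-≤ pointwise ⟩
    ∑[ i < k ] (w i * (f i * f i) + w i * (g i * g i))      ≡⟨ ∑-distrib-+ (λ i → w i * (f i * f i)) (λ i → w i * (g i * g i)) ⟩
    ∑[ i < k ] (w i * (f i * f i)) + ∑[ i < k ] (w i * (g i * g i)) ∎
    where
    open ≤-Reasoning
    pointwise : ∀ i → 2 * (w i * (f i * g i)) ≤ w i * (f i * f i) + w i * (g i * g i)
    pointwise i = begin
      2 * (w i * (f i * g i))               ≡⟨ *-CS.x∙yz≈y∙xz 2 (w i) (f i * g i) ⟩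
      w i * (2 * (f i * g i))               ≤⟨ *-monoʳ-≤ (w i) (2*m*n≤m*m+n*n (f i) (g i)) ⟩
      w i * (f i * f i + g i * g i)         ≡⟨ *-distribˡ-+ (w i) _ _ ⟩
      w i * (f i * f i) + w i * (g i * g i) ∎

  N : ∀ {k} → Fin k → Fin k → Fin k → ℕ
  N ℓ a b = free (ℓ ∷ a ∷ b ∷ [])

  U : ∀ {k} → Fin k → Fin k → Fin k → ℕ
  U {k} ℓ b a = ∑[ c < k ] ([ c ≢ b ] * (N ℓ a c * N ℓ a c))

  S : ∀ {k} → List (Fin k) → Fin k → Fin k → ℕ
  S {k} F ℓ b = ∑[ a < k ] (free (a ∷ F) * U ℓ b a)

  module _ {y : ℕ} (L : ForbiddenAssignment 5 y) (ℓ₂ ℓ₃ ℓ₄ : Fin (suc y)) (F₅ : List (Fin (suc y))) where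

    avoids⇒≢ : {c : Fin 5 → Fin (suc y)} → (∀ v → c v ∉ L v) → ∀ v {x} → x ∈ L v → c v ≢ x
    avoids⇒≢ avoids v x∈Lv cv≡x = avoids v (subst (_∈ L v) (sym cv≡x) x∈Lv)

    relaxedWeight : (Fin 5 → Fin (suc y)) → ℕ
    relaxedWeight c =
      [ c v5 ∉ c v1 ∷ F₅ ] * ([ c v3 ≢ ℓ₃ ] * ([ c v2 ∉ ℓ₂ ∷ c v1 ∷ c v3 ∷ [] ] * [ c v4 ∉ ℓ₄ ∷ c v1 ∷ c v3 ∷ [] ]))

    properAvoiding⇒relaxedWeight≡1 : ℓ₂ ∈ L v2 → ℓ₃ ∈ L v3 → ℓ₄ ∈ L v4 → All (_∈ L v5) F₅ →
                                     ∀ c → IsProperAvoiding C4plusPendant L c → relaxedWeight c ≡ 1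
    properAvoiding⇒relaxedWeight≡1 ℓ₂∈ ℓ₃∈ ℓ₄∈ F₅⊆L₅ c (proper , avoids)
      rewrite [∉]-all (proper v5 v1 tt ∷ All.map (avoids⇒≢ avoids v5) F₅⊆L₅)
            | [≢]-≢ (avoids⇒≢ avoids v3 ℓ₃∈)
            | [∉]-all (avoids⇒≢ avoids v2 ℓ₂∈ ∷ proper v2 v1 tt ∷ proper v2 v3 tt ∷ [])
            | [∉]-all (avoids⇒≢ avoids v4 ℓ₄∈ ∷ proper v4 v1 tt ∷ proper v4 v3 tt ∷ []) = refl

    sumFunctions-relaxedWeight :
      sumFunctions 5 (suc y) relaxedWeight
        ≡ ∑[ a₁ < suc y ] (free (a₁ ∷ F₅) * ∑[ a₃ < suc y ] ([ a₃ ≢ ℓ₃ ] * (N ℓ₂ a₁ a₃ * N ℓ₄ a₁ a₃)))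
    sumFunctions-relaxedWeight = sum-cong-≗ λ a₁ → let W = free (a₁ ∷ F₅) in begin
      ∑[ a₂ < suc y ] ∑[ a₃ < suc y ] ∑[ a₄ < suc y ] ∑[ a₅ < suc y ] ([ a₅ ∉ a₁ ∷ F₅ ] * R a₁ a₂ a₃ a₄)
        ≡⟨ sum-cong-≗ (λ a₂ → sum-cong-≗ λ a₃ → sum-cong-≗ λ a₄ →
             sym (*-distribʳ-sum (R a₁ a₂ a₃ a₄) (λ a₅ → [ a₅ ∉ a₁ ∷ F₅ ]))) ⟩
      ∑[ a₂ < suc y ] ∑[ a₃ < suc y ] ∑[ a₄ < suc y ] (W * R a₁ a₂ a₃ a₄)
        ≡⟨ sum-cong-≗ (λ a₂ → sum-cong-≗ λ a₃ →
             trans (∑-*ˡ W (R a₁ a₂ a₃)) (cong (W *_)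
               (trans (∑-*ˡ [ a₃ ≢ ℓ₃ ] (λ a₄ → X₂ a₁ a₂ a₃ * X₄ a₁ a₃ a₄))
                 (cong ([ a₃ ≢ ℓ₃ ] *_) (∑-*ˡ (X₂ a₁ a₂ a₃) (X₄ a₁ a₃)))))) ⟩
      ∑[ a₂ < suc y ] ∑[ a₃ < suc y ] R′ a₁ a₂ a₃
        ≡⟨ ∑-comm (R′ a₁) ⟩
      ∑[ a₃ < suc y ] ∑[ a₂ < suc y ] R′ a₁ a₂ a₃
        ≡⟨ sum-cong-≗ (λ a₃ →
             trans (∑-*ˡ W (λ a₂ → [ a₃ ≢ ℓ₃ ] * (X₂ a₁ a₂ a₃ * N ℓ₄ a₁ a₃))) (cong (W *_)
               (trans (∑-*ˡ [ a₃ ≢ ℓ₃ ] (λ a₂ → X₂ a₁ a₂ a₃ * N ℓ₄ a₁ a₃))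
                 (cong ([ a₃ ≢ ℓ₃ ] *_) (sym (*-distribʳ-sum (N ℓ₄ a₁ a₃) (λ a₂ → X₂ a₁ a₂ a₃))))))) ⟩
      ∑[ a₃ < suc y ] (W * ([ a₃ ≢ ℓ₃ ] * (N ℓ₂ a₁ a₃ * N ℓ₄ a₁ a₃)))
        ≡⟨ ∑-*ˡ W (λ a₃ → [ a₃ ≢ ℓ₃ ] * (N ℓ₂ a₁ a₃ * N ℓ₄ a₁ a₃)) ⟩
      W * ∑[ a₃ < suc y ] ([ a₃ ≢ ℓ₃ ] * (N ℓ₂ a₁ a₃ * N ℓ₄ a₁ a₃)) ∎
      where
      open ≡-Reasoning
      X₂ X₄ : Fin (suc y) → Fin (suc y) → Fin (suc y) → ℕ
      X₂ a₁ a₂ a₃ = [ a₂ ∉ ℓ₂ ∷ a₁ ∷ a₃ ∷ [] ]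
      X₄ a₁ a₃ a₄ = [ a₄ ∉ ℓ₄ ∷ a₁ ∷ a₃ ∷ [] ]
      R : Fin (suc y) → Fin (suc y) → Fin (suc y) → Fin (suc y) → ℕ
      R a₁ a₂ a₃ a₄ = [ a₃ ≢ ℓ₃ ] * (X₂ a₁ a₂ a₃ * X₄ a₁ a₃ a₄)
      R′ : Fin (suc y) → Fin (suc y) → Fin (suc y) → ℕ
      R′ a₁ a₂ a₃ = free (a₁ ∷ F₅) * ([ a₃ ≢ ℓ₃ ] * (X₂ a₁ a₂ a₃ * N ℓ₄ a₁ a₃))

    2*Q≤S+S : ℓ₂ ∈ L v2 → ℓ₃ ∈ L v3 → ℓ₄ ∈ L v4 → All (_∈ L v5) F₅ →
              2 * Q C4plusPendant y L ≤ S F₅ ℓ₂ ℓ₃ + S F₅ ℓ₄ ℓ₃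
    2*Q≤S+S ℓ₂∈ ℓ₃∈ ℓ₄∈ F₅⊆L₅ = begin
      2 * Q C4plusPendant y L
        ≤⟨ *-monoʳ-≤ 2 (length-filter-allFuns-≤ 5 (suc y) (isProperAvoiding? C4plusPendant L) weight≥1) ⟩
      2 * sumFunctions 5 (suc y) relaxedWeight              ≡⟨ cong (2 *_) sumFunctions-relaxedWeight ⟩
      2 * ∑[ a < suc y ] (W a * T a)                        ≡⟨ ∑-*ˡ 2 (λ a → W a * T a) ⟨
      ∑[ a < suc y ] (2 * (W a * T a))                      ≤⟨ ∑-mono-≤ amgm ⟩
      ∑[ a < suc y ] (W a * U ℓ₂ ℓ₃ a + W a * U ℓ₄ ℓ₃ a)
        ≡⟨ ∑-distrib-+ (λ a → W a * U ℓ₂ ℓ₃ a) (λ a → W a * U ℓ₄ ℓ₃ a) ⟩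
      S F₅ ℓ₂ ℓ₃ + S F₅ ℓ₄ ℓ₃                               ∎
      where
      open ≤-Reasoning
      W T : Fin (suc y) → ℕ
      W a = free (a ∷ F₅)
      T a = ∑[ c < suc y ] ([ c ≢ ℓ₃ ] * (N ℓ₂ a c * N ℓ₄ a c))
      weight≥1 : ∀ c → IsProperAvoiding C4plusPendant L c → 1 ≤ relaxedWeight c
      weight≥1 c proper = ≤-reflexive (sym (properAvoiding⇒relaxedWeight≡1 ℓ₂∈ ℓ₃∈ ℓ₄∈ F₅⊆L₅ c proper))
      amgm : ∀ a → 2 * (W a * T a) ≤ W a * U ℓ₂ ℓ₃ a + W a * U ℓ₄ ℓ₃ a
      amgm a = begin
        2 * (W a * T a)                        ≡⟨ *-CS.x∙yz≈y∙xz 2 (W a) (T a) ⟩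
        W a * (2 * T a)                        ≤⟨ *-monoʳ-≤ (W a) (∑-amgm (λ c → [ c ≢ ℓ₃ ]) (N ℓ₂ a) (N ℓ₄ a)) ⟩
        W a * (U ℓ₂ ℓ₃ a + U ℓ₄ ℓ₃ a)          ≡⟨ *-distribˡ-+ (W a) (U ℓ₂ ℓ₃ a) (U ℓ₄ ℓ₃ a) ⟩
        W a * U ℓ₂ ℓ₃ a + W a * U ℓ₄ ℓ₃ a      ∎

  ≤-half : ∀ {m n} → 2 * m ≤ n + n → m ≤ n
  ≤-half {m} {n} 2m≤n+n = *-cancelˡ-≤ 2 (subst (2 * m ≤_) (cong (n +_) (sym (+-identityʳ n))) 2m≤n+n)

  horner : ℕ → List ℕ → ℕ → ℕ
  horner c₀ []       x = c₀
  horner c₀ (c ∷ cs) x = c₀ + x * horner c cs x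

  module _ (z : ℕ) where

    K₁ K₂ K₃ : ℕ
    K₁ = 1 + z
    K₂ = 2 + z
    K₃ = 3 + z

    free-≤-K₃ : ∀ {x} {ys : List (Fin (4 + z))} → (∀ {c} → All (c ≢_) ys → c ≢ x) → free ys ≤ K₃
    free-≤-K₃ ys⇒≢x = free-≤ ([] ∷ []) refl (λ c∉ys → ys⇒≢x c∉ys ∷ [])

    free-≤-K₂ : ∀ {x x′} {ys : List (Fin (4 + z))} → x ≢ x′ →
                (∀ {c} → All (c ≢_) ys → All (c ≢_) (x ∷ x′ ∷ [])) → free ys ≤ K₂
    free-≤-K₂ x≢x′ = free-≤ ((x≢x′ ∷ []) ∷ [] ∷ []) refl

    free-≤-K₁ : ∀ {x x′ x″ : Fin (4 + z)} → x ≢ x′ → x ≢ x″ → x′ ≢ x″ → free (x ∷ x′ ∷ x″ ∷ []) ≤ K₁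
    free-≤-K₁ x≢x′ x≢x″ x′≢x″ = free-≤ ((x≢x′ ∷ x≢x″ ∷ []) ∷ (x′≢x″ ∷ []) ∷ [] ∷ []) refl (λ c∉xs → c∉xs)

    N-≤-K₃ : ∀ ℓ a b → N ℓ a b ≤ K₃
    N-≤-K₃ ℓ a b = free-≤-K₃ {ys = ℓ ∷ a ∷ b ∷ []} λ { (c≢ℓ ∷ _) → c≢ℓ }

    N-≤-K₂ˡ : ∀ ℓ {a} b → a ≢ ℓ → N ℓ a b ≤ K₂
    N-≤-K₂ˡ ℓ {a} b a≢ℓ = free-≤-K₂ {ys = ℓ ∷ a ∷ b ∷ []} (≢-sym a≢ℓ) λ { (c≢ℓ ∷ c≢a ∷ _) → c≢ℓ ∷ c≢a ∷ [] }

    N-≤-K₂ʳ : ∀ ℓ a {b} → b ≢ ℓ → N ℓ a b ≤ K₂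
    N-≤-K₂ʳ ℓ a {b} b≢ℓ = free-≤-K₂ {ys = ℓ ∷ a ∷ b ∷ []} (≢-sym b≢ℓ) λ { (c≢ℓ ∷ _ ∷ c≢b ∷ []) → c≢ℓ ∷ c≢b ∷ [] }

    -- Bounds at the distinguished colour ℓ (ᵖ) and away from it (ᵒ).
    Uᵖ Uᵒ Mᵖ Mᵒ ∑Uᵇ : ℕ
    Uᵖ  = 1 * (K₃ * K₃) + K₂ * (K₂ * K₂)
    Uᵒ  = 2 * (K₂ * K₂) + K₁ * (K₁ * K₁)
    Mᵖ  = 1 * (K₃ * K₃) + K₃ * (K₂ * K₂)
    Mᵒ  = 2 * (K₂ * K₂) + K₂ * (K₁ * K₁)
    ∑Uᵇ = 1 * Mᵖ + K₂ * Mᵒ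

    Mᵒ≤Mᵖ : Mᵒ ≤ Mᵖ
    Mᵒ≤Mᵖ = subst (Mᵒ ≤_) (sym (gap z)) (m≤m+n Mᵒ (11 + z * (9 + 2 * z)))
      where
      gap : ∀ z → let K₁ = 1 + z; K₂ = 2 + z; K₃ = 3 + z in
            1 * (K₃ * K₃) + K₃ * (K₂ * K₂) ≡ 2 * (K₂ * K₂) + K₂ * (K₁ * K₁) + (11 + z * (9 + 2 * z))
      gap = solve-∀

    U-≤ : ∀ ℓ b a → U ℓ b a ≤ Uᵖ
    U-≤ ℓ b a = ∑-punctured-≤-peaks {f = λ c → N ℓ a c * N ℓ a c} ([] ∷ []) refl
      (square-mono (N-≤-K₃ ℓ a ℓ) ∷ []) (λ { c (c≢ℓ ∷ []) → square-mono (N-≤-K₂ʳ ℓ a c≢ℓ) })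
      (square-mono (n≤1+n K₂)) b

    U-≤-off : ∀ ℓ b {a} → a ≢ ℓ → U ℓ b a ≤ Uᵒ
    U-≤-off ℓ b {a} a≢ℓ = ∑-punctured-≤-peaks {f = λ c → N ℓ a c * N ℓ a c} ((≢-sym a≢ℓ ∷ []) ∷ [] ∷ []) refl
      (square-mono (N-≤-K₂ˡ ℓ ℓ a≢ℓ) ∷ square-mono (N-≤-K₂ˡ ℓ a a≢ℓ) ∷ [])
      (λ { c (c≢ℓ ∷ c≢a ∷ []) → square-mono (free-≤-K₁ {ℓ} {a} {c} (≢-sym a≢ℓ) (≢-sym c≢ℓ) (≢-sym c≢a)) })
      (square-mono (n≤1+n K₁)) b

    M : Fin (4 + z) → Fin (4 + z) → ℕ
    M ℓ c = ∑[ a < 4 + z ] (N ℓ a c * N ℓ a c)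

    M-≤-peak : ∀ ℓ → M ℓ ℓ ≤ Mᵖ
    M-≤-peak ℓ = ∑-≤-peaks {f = λ a → N ℓ a ℓ * N ℓ a ℓ} ([] ∷ []) refl
      (square-mono (N-≤-K₃ ℓ ℓ ℓ) ∷ []) (λ { a (a≢ℓ ∷ []) → square-mono (N-≤-K₂ˡ ℓ ℓ a≢ℓ) })

    M-≤-off : ∀ ℓ {c} → c ≢ ℓ → M ℓ c ≤ Mᵒ
    M-≤-off ℓ {c} c≢ℓ = ∑-≤-peaks {f = λ a → N ℓ a c * N ℓ a c} ((≢-sym c≢ℓ ∷ []) ∷ [] ∷ []) refl
      (square-mono (N-≤-K₂ʳ ℓ ℓ c≢ℓ) ∷ square-mono (N-≤-K₂ʳ ℓ c c≢ℓ) ∷ [])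
      (λ { a (a≢ℓ ∷ a≢c ∷ []) → square-mono (free-≤-K₁ {ℓ} {a} {c} (≢-sym a≢ℓ) (≢-sym c≢ℓ) a≢c) })

    ∑U-≤ : ∀ ℓ b → ∑[ a < 4 + z ] U ℓ b a ≤ ∑Uᵇ
    ∑U-≤ ℓ b = begin
      ∑[ a < 4 + z ] ∑[ c < 4 + z ] ([ c ≢ b ] * (N ℓ a c * N ℓ a c))
        ≡⟨ ∑-comm (λ a c → [ c ≢ b ] * (N ℓ a c * N ℓ a c)) ⟩
      ∑[ c < 4 + z ] ∑[ a < 4 + z ] ([ c ≢ b ] * (N ℓ a c * N ℓ a c))
        ≡⟨ sum-cong-≗ (λ c → ∑-*ˡ [ c ≢ b ] (λ a → N ℓ a c * N ℓ a c)) ⟩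
      ∑[ c < 4 + z ] ([ c ≢ b ] * M ℓ c)
        ≤⟨ ∑-punctured-≤-peaks {f = M ℓ} ([] ∷ []) refl (M-≤-peak ℓ ∷ []) (λ { c (c≢ℓ ∷ []) → M-≤-off ℓ c≢ℓ }) Mᵒ≤Mᵖ b ⟩
      ∑Uᵇ ∎
      where open ≤-Reasoning

    U-pair-≤ : ∀ ℓ b {c c′} → c ≢ c′ → U ℓ b c + (U ℓ b c′ + 0) ≤ Uᵖ + Uᵒ
    U-pair-≤ ℓ b {c} {c′} c≢c′ with c ≟ ℓ
    ... | yes refl = +-mono-≤ (U-≤ ℓ b c) (≤-trans (≤-reflexive (+-identityʳ _)) (U-≤-off ℓ b (≢-sym c≢c′)))
    ... | no c≢ℓ   = subst (U ℓ b c + (U ℓ b c′ + 0) ≤_) (+-comm Uᵒ Uᵖ)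
                       (+-mono-≤ (U-≤-off ℓ b c≢ℓ) (≤-trans (≤-reflexive (+-identityʳ _)) (U-≤ ℓ b c′)))

    S-≤ᵃ : ∀ ℓ b ℓ₅ → S (ℓ₅ ∷ []) ℓ b ≤ Uᵖ + K₂ * ∑Uᵇ
    S-≤ᵃ ℓ b ℓ₅ = begin
      S (ℓ₅ ∷ []) ℓ b
        ≤⟨ ∑-weighted-≤-peaks {n = K₂} {w = λ a → free (a ∷ ℓ₅ ∷ [])} ([] ∷ [])
             (free-≤-K₃ {ys = ℓ₅ ∷ ℓ₅ ∷ []} (λ { (_ ∷ c≢ℓ₅ ∷ []) → c≢ℓ₅ }) ∷ [])
             (λ { a (a≢ℓ₅ ∷ []) → free-≤-K₂ {ys = a ∷ ℓ₅ ∷ []} a≢ℓ₅ (λ c∉ys → c∉ys) }) (U ℓ b) ⟩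
      U ℓ b ℓ₅ + 0 + K₂ * ∑[ a < 4 + z ] U ℓ b a
        ≤⟨ +-mono-≤ (≤-trans (≤-reflexive (+-identityʳ _)) (U-≤ ℓ b ℓ₅)) (*-monoʳ-≤ K₂ (∑U-≤ ℓ b)) ⟩
      Uᵖ + K₂ * ∑Uᵇ ∎
      where open ≤-Reasoning

    S-≤ᵇ : ∀ ℓ b {ℓ₅ ℓ₅′} → ℓ₅ ≢ ℓ₅′ → S (ℓ₅ ∷ ℓ₅′ ∷ []) ℓ b ≤ Uᵖ + Uᵒ + K₁ * ∑Uᵇ
    S-≤ᵇ ℓ b {ℓ₅} {ℓ₅′} ℓ₅≢ℓ₅′ = begin
      S (ℓ₅ ∷ ℓ₅′ ∷ []) ℓ b
        ≤⟨ ∑-weighted-≤-peaks {n = K₁} {w = λ a → free (a ∷ ℓ₅ ∷ ℓ₅′ ∷ [])} ((ℓ₅≢ℓ₅′ ∷ []) ∷ [] ∷ [])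
             (free-≤-K₂ {ys = ℓ₅ ∷ ℓ₅ ∷ ℓ₅′ ∷ []} ℓ₅≢ℓ₅′ (λ { (_ ∷ c∉ℓ₅ℓ₅′) → c∉ℓ₅ℓ₅′ })
               ∷ free-≤-K₂ {ys = ℓ₅′ ∷ ℓ₅ ∷ ℓ₅′ ∷ []} ℓ₅≢ℓ₅′ (λ { (_ ∷ c∉ℓ₅ℓ₅′) → c∉ℓ₅ℓ₅′ }) ∷ [])
             (λ { a (a≢ℓ₅ ∷ a≢ℓ₅′ ∷ []) → free-≤-K₁ a≢ℓ₅ a≢ℓ₅′ ℓ₅≢ℓ₅′ }) (U ℓ b) ⟩
      U ℓ b ℓ₅ + (U ℓ b ℓ₅′ + 0) + K₁ * ∑[ a < 4 + z ] U ℓ b a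
        ≤⟨ +-mono-≤ (U-pair-≤ ℓ b ℓ₅≢ℓ₅′) (*-monoʳ-≤ K₁ (∑U-≤ ℓ b)) ⟩
      Uᵖ + Uᵒ + K₁ * ∑Uᵇ ∎
      where open ≤-Reasoning

    Q-≤ᵃ : (L : ForbiddenAssignment 5 (3 + z)) {ℓ₂ ℓ₃ ℓ₄ ℓ₅ : Fin (4 + z)} →
           ℓ₂ ∈ L v2 → ℓ₃ ∈ L v3 → ℓ₄ ∈ L v4 → ℓ₅ ∈ L v5 →
           Q C4plusPendant (3 + z) L ≤ horner 99 (175 ∷ 131 ∷ 52 ∷ 11 ∷ 1 ∷ []) z
    Q-≤ᵃ L {ℓ₂} {ℓ₃} {ℓ₄} {ℓ₅} ℓ₂∈ ℓ₃∈ ℓ₄∈ ℓ₅∈ = begin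
      Q C4plusPendant (3 + z) L
        ≤⟨ ≤-half (≤-trans (2*Q≤S+S L ℓ₂ ℓ₃ ℓ₄ (ℓ₅ ∷ []) ℓ₂∈ ℓ₃∈ ℓ₄∈ (ℓ₅∈ ∷ []))
                           (+-mono-≤ (S-≤ᵃ ℓ₂ ℓ₃ ℓ₅) (S-≤ᵃ ℓ₄ ℓ₃ ℓ₅))) ⟩
      Uᵖ + K₂ * ∑Uᵇ                                             ≡⟨ expand z ⟩
      horner 99 (175 ∷ 131 ∷ 52 ∷ 11 ∷ 1 ∷ []) z                ∎
      where
      open ≤-Reasoning
      expand : ∀ z → let K₁ = 1 + z; K₂ = 2 + z; K₃ = 3 + z in
               1 * (K₃ * K₃) + K₂ * (K₂ * K₂) + K₂ * (1 * (1 * (K₃ * K₃) + K₃ * (K₂ * K₂)) + K₂ * (2 * (K₂ * K₂) + K₂ * (K₁ * K₁)))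
                 ≡ 99 + z * (175 + z * (131 + z * (52 + z * (11 + z * 1))))
      expand = solve-∀

    Q-≤ᵇ : (L : ForbiddenAssignment 5 (3 + z)) {ℓ₂ ℓ₃ ℓ₄ ℓ₅ ℓ₅′ : Fin (4 + z)} →
           ℓ₂ ∈ L v2 → ℓ₃ ∈ L v3 → ℓ₄ ∈ L v4 → ℓ₅ ∈ L v5 → ℓ₅′ ∈ L v5 → ℓ₅ ≢ ℓ₅′ →
           Q C4plusPendant (3 + z) L ≤ horner 67 (128 ∷ 103 ∷ 44 ∷ 10 ∷ 1 ∷ []) z
    Q-≤ᵇ L {ℓ₂} {ℓ₃} {ℓ₄} {ℓ₅} {ℓ₅′} ℓ₂∈ ℓ₃∈ ℓ₄∈ ℓ₅∈ ℓ₅′∈ ℓ₅≢ℓ₅′ = begin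
      Q C4plusPendant (3 + z) L
        ≤⟨ ≤-half (≤-trans (2*Q≤S+S L ℓ₂ ℓ₃ ℓ₄ (ℓ₅ ∷ ℓ₅′ ∷ []) ℓ₂∈ ℓ₃∈ ℓ₄∈ (ℓ₅∈ ∷ ℓ₅′∈ ∷ []))
                           (+-mono-≤ (S-≤ᵇ ℓ₂ ℓ₃ ℓ₅≢ℓ₅′) (S-≤ᵇ ℓ₄ ℓ₃ ℓ₅≢ℓ₅′))) ⟩
      Uᵖ + Uᵒ + K₁ * ∑Uᵇ                                        ≡⟨ expand z ⟩
      horner 67 (128 ∷ 103 ∷ 44 ∷ 10 ∷ 1 ∷ []) z                ∎
      where
      open ≤-Reasoning
      expand : ∀ z → let K₁ = 1 + z; K₂ = 2 + z; K₃ = 3 + z in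
               1 * (K₃ * K₃) + K₂ * (K₂ * K₂) + (2 * (K₂ * K₂) + K₁ * (K₁ * K₁))
                 + K₁ * (1 * (1 * (K₃ * K₃) + K₃ * (K₂ * K₂)) + K₂ * (2 * (K₂ * K₂) + K₂ * (K₁ * K₁)))
                 ≡ 67 + z * (128 + z * (103 + z * (44 + z * (10 + z * 1))))
      expand = solve-∀

  ∣p∣≥1⇒nonempty : ∀ {n} (p : Subset n) → 1 ≤ ∣ p ∣ → Nonempty p
  ∣p∣≥1⇒nonempty (inside ∷ p)  _ = zero , here
  ∣p∣≥1⇒nonempty (outside ∷ p) 1≤∣p∣ with x , x∈p ← ∣p∣≥1⇒nonempty p 1≤∣p∣ = suc x , there x∈p

  ∣p∣≥2⇒two-members : ∀ {n} (p : Subset n) → 2 ≤ ∣ p ∣ → ∃₂ λ x x′ → x ∈ p × x′ ∈ p × x ≢ x′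
  ∣p∣≥2⇒two-members (inside ∷ p) (s≤s 1≤∣p∣) with x , x∈p ← ∣p∣≥1⇒nonempty p 1≤∣p∣ =
    zero , suc x , here , there x∈p , λ ()
  ∣p∣≥2⇒two-members (outside ∷ p) 2≤∣p∣ with x , x′ , x∈p , x′∈p , x≢x′ ← ∣p∣≥2⇒two-members p 2≤∣p∣ =
    suc x , suc x′ , there x∈p , there x′∈p , x≢x′ ∘ Fin-suc-injective

open import Data.Nat using (ℕ; _≥_; suc; s≤s; z≤n)
import Data.Nat as ℕ
open import Data.Integer using (ℤ; +_; _+_; _-_; _*_; _^_; _≤_; +≤+)
open import Data.Integer.Properties using (pos-*)
open import Data.Integer.Tactic.RingSolver using (solve-∀)
open import Data.Fin.Subset using (Nonempty; ∣_∣)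
open import Data.List using (List; []; _∷_)
open import Data.Product using (_×_; _,_)
open import Relation.Binary.PropositionalEquality using (_≡_; refl; cong; trans; subst)

hornerℤ : ℕ → List ℕ → ℤ → ℤ
hornerℤ c₀ []       x = + c₀
hornerℤ c₀ (c ∷ cs) x = + c₀ + x * hornerℤ c cs x

pos-horner : ∀ c₀ cs x → + horner c₀ cs x ≡ hornerℤ c₀ cs (+ x)
pos-horner c₀ []       x = refl
pos-horner c₀ (c ∷ cs) x = cong (λ t → + c₀ + t) (trans (pos-* x (horner c cs x)) (cong (+ x *_) (pos-horner c cs x)))

+-mono-≤-horner : ∀ c₀ cs x {q} → q ℕ.≤ horner c₀ cs x → + q ≤ hornerℤ c₀ cs (+ x)
+-mono-≤-horner c₀ cs x {q} q≤horner = subst (+ q ≤_) (pos-horner c₀ cs x) (+≤+ q≤horner)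

≤-polynomialᵃ : ∀ z {q} → q ℕ.≤ horner 99 (175 ∷ 131 ∷ 52 ∷ 11 ∷ 1 ∷ []) z → let y = 3 ℕ.+ z in
                + q ≤ (+ y) ^ 5 - + 4 * (+ y) ^ 4 + + 10 * (+ y) ^ 3 - + 13 * (+ y) ^ 2 + + 10 * (+ y) - + 3
≤-polynomialᵃ z {q} q≤horner = subst (+ q ≤_) (expand (+ z)) (+-mono-≤-horner 99 (175 ∷ 131 ∷ 52 ∷ 11 ∷ 1 ∷ []) z q≤horner)
  where
  expand : ∀ x → let y = + 3 + x in
           + 99 + x * (+ 175 + x * (+ 131 + x * (+ 52 + x * (+ 11 + x * + 1))))
             ≡ y * (y * (y * (y * (y * + 1)))) - + 4 * (y * (y * (y * (y * + 1)))) + + 10 * (y * (y * (y * + 1)))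
               - + 13 * (y * (y * + 1)) + + 10 * y - + 3
  expand = solve-∀

≤-polynomialᵇ : ∀ z {q} → q ℕ.≤ horner 67 (128 ∷ 103 ∷ 44 ∷ 10 ∷ 1 ∷ []) z → let y = 3 ℕ.+ z in
                + q ≤ (+ y) ^ 5 - + 5 * (+ y) ^ 4 + + 14 * (+ y) ^ 3 - + 23 * (+ y) ^ 2 + + 23 * (+ y) - + 11
≤-polynomialᵇ z {q} q≤horner = subst (+ q ≤_) (expand (+ z)) (+-mono-≤-horner 67 (128 ∷ 103 ∷ 44 ∷ 10 ∷ 1 ∷ []) z q≤horner)
  where
  expand : ∀ x → let y = + 3 + x in
           + 67 + x * (+ 128 + x * (+ 103 + x * (+ 44 + x * (+ 10 + x * + 1))))
             ≡ y * (y * (y * (y * (y * + 1)))) - + 5 * (y * (y * (y * (y * + 1)))) + + 14 * (y * (y * (y * + 1)))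
               - + 23 * (y * (y * + 1)) + + 23 * y - + 11
  expand = solve-∀

proposition3p5 : (y : ℕ) → y ≥ 3 → (L : ForbiddenAssignment 5 y)
    → Nonempty (L v2) → Nonempty (L v3) → Nonempty (L v4) → Nonempty (L v5)
    → ((+ Q C4plusPendant y L) ≤ (+ y) ^ 5 - + 4 * (+ y) ^ 4 + + 10 * (+ y) ^ 3 - + 13 * (+ y) ^ 2 + + 10 * (+ y) - + 3)
      × (∣ L v5 ∣ ≥ 2 → (+ Q C4plusPendant y L) ≤ (+ y) ^ 5 - + 5 * (+ y) ^ 4 + + 14 * (+ y) ^ 3 - + 23 * (+ y) ^ 2 + + 23 * (+ y) - + 11)
proposition3p5 (suc (suc (suc z))) (s≤s (s≤s (s≤s z≤n))) L (ℓ₂ , ℓ₂∈) (ℓ₃ , ℓ₃∈) (ℓ₄ , ℓ₄∈) (ℓ₅ , ℓ₅∈) =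
    ≤-polynomialᵃ z (Q-≤ᵃ z L ℓ₂∈ ℓ₃∈ ℓ₄∈ ℓ₅∈)
  , λ ∣L₅∣≥2 → let (ℓ , ℓ′ , ℓ∈ , ℓ′∈ , ℓ≢ℓ′) = ∣p∣≥2⇒two-members (L v5) ∣L₅∣≥2 in
      ≤-polynomialᵇ z (Q-≤ᵇ z L ℓ₂∈ ℓ₃∈ ℓ₄∈ ℓ∈ ℓ′∈ ℓ≢ℓ′)
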